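{- Let $G$ be a connected non-complete graph. The following are equivalent: (i) $\mu_t(G)= {\rm n}(G)-\gamma_c(G)$; (ii) there exists a minimum connected dominating set $S$ of $G$ (of cardinality $\gamma_c(G)$) such that for every pair $u,v$ of vertices of $G$ there exists a shortest path $u=y_0,\dots, y_{k'}=v$ with $\{y_1,\dots, y_{k'-1}\}\subseteq S$.
   Context: All graphs are finite, simple and undirected. ${\rm n}(G)$ is the order of $G$ and $\gamma_c(G)$ the connected domination number (minimum cardinality of a dominating set inducing a connected subgraph). For $X\subseteq V(G)$, two vertices $x,y\in V(G)$ are $X$-visible if there is a shortest $x,y$-path in $G$ none of whose internal vertices lies in $X$. $X$ is a total mutual-visibility set of $G$ if every two vertices of $G$ are $X$-visible; $\mu_t(G)$ is the maximum cardinality of such a set. -}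

module Defs where

open import Data.Nat using (ℕ; zero; suc; _≤_; _∸_)
open import Data.Fin using (Fin)
open import Data.Fin.Subset using (Subset; _∈_; _∉_; ∣_∣)
open import Data.Bool using (Bool; true; false)
open import Data.Product using (Σ; ∃; ∃-syntax; _×_; _,_)
open import Data.Sum using (_⊎_)
open import Data.Unit using (⊤)
open import Relation.Binary.PropositionalEquality using (_≡_; _≢_)

record Graph : Set where
  field
    n      : ℕ
    adj    : Fin n → Fin n → Bool
    sym    : ∀ x y → adj x y ≡ adj y x
    irrefl : ∀ x → adj x x ≡ false

open Graph public

module _ (G : Graph) where

  V : Set
  V = Fin (n G)

  Adj : V → V → Set
  Adj x y = adj G x y ≡ true

  data Walk : V → V → ℕ → Set where
    nil  : ∀ {x} → Walk x x 0
    cons : ∀ {x y z k} → Adj x y → Walk y z k → Walk x z (suc k)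

  AllVerts : (V → Set) → ∀ {x y k} → Walk x y k → Set
  AllVerts P (nil {x}) = P x
  AllVerts P (cons {x} e w) = P x × AllVerts P w

  AllInternal : (V → Set) → ∀ {x y k} → Walk x y k → Set
  AllInternal P nil = ⊤
  AllInternal P (cons e nil) = ⊤
  AllInternal P (cons {y = y} e (cons e' w)) = P y × AllInternal P (cons e' w)

  IsShortest : ∀ {x y k} → Walk x y k → Set
  IsShortest {x} {y} {k} w = ∀ {k'} → Walk x y k' → k ≤ k'

  Connected : Set
  Connected = ∀ x y → ∃[ k ] Walk x y k

  NonComplete : Set
  NonComplete = ∃[ x ] ∃[ y ] (x ≢ y × adj G x y ≡ false)

  Visible : Subset (n G) → V → V → Set
  Visible X x y = ∃[ k ] Σ (Walk x y k) λ w → IsShortest w × AllInternal (_∉ X) w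

  IsTotalMutualVisibility : Subset (n G) → Set
  IsTotalMutualVisibility X = ∀ x y → Visible X x y

  IsMuT : ℕ → Set
  IsMuT m = (∃[ X ] (IsTotalMutualVisibility X × ∣ X ∣ ≡ m))
          × (∀ X → IsTotalMutualVisibility X → ∣ X ∣ ≤ m)

  Dominating : Subset (n G) → Set
  Dominating S = ∀ v → v ∈ S ⊎ (∃[ u ] (u ∈ S × Adj u v))

  InducesConnected : Subset (n G) → Set
  InducesConnected S = ∀ u v → u ∈ S → v ∈ S →
    ∃[ k ] Σ (Walk u v k) λ w → AllVerts (_∈ S) w

  ConnectedDominating : Subset (n G) → Set
  ConnectedDominating S = Dominating S × InducesConnected S

  IsGammaC : ℕ → Set
  IsGammaC c = (∃[ S ] (ConnectedDominating S × ∣ S ∣ ≡ c))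
             × (∀ S → ConnectedDominating S → c ≤ ∣ S ∣)

-- A set X is a total mutual-visibility set exactly when every two vertices are joined by a
-- shortest path whose interior avoids X, i.e. lies in the complement of X.  In a non-complete
-- graph any set S through which all pairs are joined by shortest paths is a connected dominating
-- set: a shortest path between two non-adjacent vertices has an interior vertex z ∈ S, the first
-- step of a shortest path from any vertex to z lands in S, and a shortest path between two
-- vertices of S lies entirely in S.  Hence the complement of a total mutual-visibility set has
-- at least γ_c vertices, so μ_t ≤ n − γ_c, with equality exactly when such a complement can be a
-- minimum connected dominating set.
module Submission where

open import Defs
open import Data.Nat using (ℕ; _∸_; _≤_; suc)
open import Data.Nat.Properties using (≤-antisym; ∸-monoʳ-≤; m∸[m∸n]≡n)
open import Data.Fin.Subset using (Subset; _∈_; ∣_∣; ∁)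
open import Data.Fin.Subset.Properties
  using (_∈?_; ∣p∣≤n; x∈p⇒x∉∁p; x∉p⇒x∈∁p; ∣∁p∣≡n∸∣p∣)
open import Data.Product using (Σ; ∃; ∃-syntax; _×_; _,_)
open import Data.Sum using (inj₁; inj₂)
open import Data.Unit using (tt)
open import Data.Empty using (⊥-elim)
open import Relation.Nullary using (yes; no)
open import Relation.Binary.PropositionalEquality
  using (_≡_; refl; trans; subst; cong)
  renaming (sym to ≡-sym)
open import Function.Bundles using (_⇔_; mk⇔)

∣∁p∣≡n∸k : ∀ {N k} (p : Subset N) → ∣ p ∣ ≡ k → ∣ ∁ p ∣ ≡ N ∸ k
∣∁p∣≡n∸k {N} p ∣p∣≡k = trans (∣∁p∣≡n∸∣p∣ p) (cong (N ∸_) ∣p∣≡k)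

module _ (G : Graph) where

  GeodesicsThrough : (V G → Set) → Set
  GeodesicsThrough P =
    ∀ u v → ∃[ k ] Σ (Walk G u v k) λ w → IsShortest G w × AllInternal G P w

  AllInternal-map : ∀ {P Q : V G → Set} → (∀ v → P v → Q v) →
    ∀ {x y k} (w : Walk G x y k) → AllInternal G P w → AllInternal G Q w
  AllInternal-map f nil _ = tt
  AllInternal-map f (cons e nil) _ = tt
  AllInternal-map f (cons {y = y} e (cons e′ w)) (p , ps) =
    f y p , AllInternal-map f (cons e′ w) ps

  AllInternal⇒AllVerts : ∀ {P : V G → Set} {x y k} (w : Walk G x y k) →
    P x → P y → AllInternal G P w → AllVerts G P w
  AllInternal⇒AllVerts nil px _ _ = px
  AllInternal⇒AllVerts (cons e nil) px py _ = px , py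
  AllInternal⇒AllVerts (cons e (cons e′ w)) px py (p , ps) =
    px , AllInternal⇒AllVerts (cons e′ w) p py ps

  GeodesicsThrough-mono : ∀ {P Q : V G → Set} → (∀ v → P v → Q v) →
    GeodesicsThrough P → GeodesicsThrough Q
  GeodesicsThrough-mono f geo u v with geo u v
  ... | k , w , shortest , internal = k , w , shortest , AllInternal-map f w internal

  nonComplete⇒internalVertex : ∀ {P : V G → Set} → NonComplete G →
    GeodesicsThrough P → ∃ P
  nonComplete⇒internalVertex (x , y , x≢y , x≁y) geo with geo x y
  ... | _ , nil , _ , _ = ⊥-elim (x≢y refl)
  ... | _ , cons x∼y nil , _ , _ with () ← trans (≡-sym x∼y) x≁y
  ... | _ , cons {y = z} _ (cons _ _) , _ , (pz , _) = z , pz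

  firstStep-∈ : ∀ {P : V G → Set} {v z k} (w : Walk G v z (suc k)) →
    P z → AllInternal G P w → ∃[ u ] (P u × Adj G u v)
  firstStep-∈ (cons {y = u} v∼u nil) pu _ = u , pu , trans (Graph.sym G u _) v∼u
  firstStep-∈ (cons {y = u} v∼u (cons _ _)) _ (pu , _) = u , pu , trans (Graph.sym G u _) v∼u

  GeodesicsThrough⇒Dominating : ∀ {S} → NonComplete G →
    GeodesicsThrough (_∈ S) → Dominating G S
  GeodesicsThrough⇒Dominating {S} nc geo v with v ∈? S
  ... | yes v∈S = inj₁ v∈S
  ... | no v∉S with nonComplete⇒internalVertex nc geo
  ...   | z , z∈S with geo v z
  ...     | _ , nil , _ , _ = ⊥-elim (v∉S z∈S)
  ...     | _ , w@(cons _ _) , _ , internal = inj₂ (firstStep-∈ w z∈S internal)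

  GeodesicsThrough⇒InducesConnected : ∀ {S} →
    GeodesicsThrough (_∈ S) → InducesConnected G S
  GeodesicsThrough⇒InducesConnected geo u v u∈S v∈S with geo u v
  ... | k , w , _ , internal = k , w , AllInternal⇒AllVerts w u∈S v∈S internal

  GeodesicsThrough⇒ConnectedDominating : ∀ {S} → NonComplete G →
    GeodesicsThrough (_∈ S) → ConnectedDominating G S
  GeodesicsThrough⇒ConnectedDominating nc geo =
    GeodesicsThrough⇒Dominating nc geo , GeodesicsThrough⇒InducesConnected geo

  totalMutualVisibility⇒∁-ConnectedDominating : NonComplete G →
    ∀ X → IsTotalMutualVisibility G X → ConnectedDominating G (∁ X)
  totalMutualVisibility⇒∁-ConnectedDominating nc X tmv =
    GeodesicsThrough⇒ConnectedDominating nc (GeodesicsThrough-mono (λ _ → x∉p⇒x∈∁p) tmv)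

  totalMutualVisibility-size≤n∸γc : ∀ {c} → NonComplete G →
    (∀ S → ConnectedDominating G S → c ≤ ∣ S ∣) →
    ∀ X → IsTotalMutualVisibility G X → ∣ X ∣ ≤ n G ∸ c
  totalMutualVisibility-size≤n∸γc {c} nc minimal X tmv =
    subst (_≤ n G ∸ c) (m∸[m∸n]≡n (∣p∣≤n X)) (∸-monoʳ-≤ (n G) c≤∣∁X∣)
    where
    c≤∣∁X∣ : c ≤ n G ∸ ∣ X ∣
    c≤∣∁X∣ = subst (c ≤_) (∣∁p∣≡n∸∣p∣ X)
      (minimal (∁ X) (totalMutualVisibility⇒∁-ConnectedDominating nc X tmv))

proposition2p6 : (G : Graph) → Connected G → NonComplete G →
    (m c : ℕ) → IsMuT G m → IsGammaC G c →
    (m ≡ n G ∸ c) ⇔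
    (∃[ S ] (ConnectedDominating G S × ∣ S ∣ ≡ c ×
      (∀ u v → ∃[ k ] Σ (Walk G u v k) λ w → IsShortest G w × AllInternal G (_∈ S) w)))
proposition2p6 G _ nc m c ((X₀ , tmvX₀ , ∣X₀∣≡m) , maximal) ((S₀ , _ , ∣S₀∣≡c) , minimal) =
  mk⇔ optimal⇒ ⇒optimal
  where
  MinimumGeodesicCDS : Set
  MinimumGeodesicCDS =
    ∃[ S ] (ConnectedDominating G S × ∣ S ∣ ≡ c × GeodesicsThrough G (_∈ S))

  optimal⇒ : m ≡ n G ∸ c → MinimumGeodesicCDS
  optimal⇒ m≡n∸c =
    ∁ X₀ , totalMutualVisibility⇒∁-ConnectedDominating G nc X₀ tmvX₀ , ∣∁X₀∣≡c , geo
    where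
    geo : GeodesicsThrough G (_∈ ∁ X₀)
    geo = GeodesicsThrough-mono G (λ _ → x∉p⇒x∈∁p) tmvX₀
    ∣∁X₀∣≡c : ∣ ∁ X₀ ∣ ≡ c
    ∣∁X₀∣≡c = trans (∣∁p∣≡n∸k X₀ (trans ∣X₀∣≡m m≡n∸c))
                    (m∸[m∸n]≡n (subst (_≤ n G) ∣S₀∣≡c (∣p∣≤n S₀)))

  ⇒optimal : MinimumGeodesicCDS → m ≡ n G ∸ c
  ⇒optimal (S , _ , ∣S∣≡c , geo) = ≤-antisym
    (subst (_≤ n G ∸ c) ∣X₀∣≡m (totalMutualVisibility-size≤n∸γc G nc minimal X₀ tmvX₀))
    (subst (_≤ m) (∣∁p∣≡n∸k S ∣S∣≡c)
      (maximal (∁ S) (GeodesicsThrough-mono G (λ _ → x∈p⇒x∉∁p) geo)))
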